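{- Every nonnegative integer $\lambda$ with $\lambda \equiv 0 \pmod 6$ or $\lambda \equiv 2 \pmod 6$ is the character of some independent Stanley sequence. Moreover, each such $\lambda$ can be achieved as the character of an independent Stanley sequence that is basic.
   Context: A set of integers is 3-free if it contains no nontrivial 3-term arithmetic progression. For a finite 3-free set $A$ of nonnegative integers containing $0$, the Stanley sequence $S(A)$ is the increasing sequence obtained by listing $A$ in increasing order and then repeatedly appending the least integer larger than the current last term keeping the set 3-free; its terms are written $a_0 = 0 < a_1 < a_2 < \cdots$. A Stanley sequence $(a_n)$ is independent if there exist constants $\lambda$ and $\chi$ such that for all $k \ge \chi$ and $0 \le i < 2^k$: $a_{2^k+i} = a_{2^k} + a_i$ and $a_{2^k} = 2a_{2^k-1} - \lambda + 1$; $\lambda$ is its character. A Stanley sequence is basic if there is a sequence $B = (b_k)_{k\ge 0}$ (its basis) with $b_k = \alpha \cdot 3^k$ for all sufficiently large $k$ (for some constant $\alpha$) such that the set of terms of the Stanley sequence equals $\{\sum_{k} \delta_k b_k : \delta_k \in \{0,1\}, \sum_k \delta_k < \infty\}$. -}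

module Defs where

open import Data.Nat using (ℕ; zero; suc; _+_; _*_; _∸_; _^_; _≤_; _<_)
open import Data.Bool using (Bool; if_then_else_)
open import Data.List using (List; length; lookup)
open import Data.List.Membership.Propositional using (_∈_)
open import Data.List.Relation.Unary.Linked using (Linked)
open import Data.Fin using (fromℕ<)
open import Data.Product using (Σ; ∃; ∃-syntax; _×_; _,_)
open import Data.Sum using (_⊎_)
open import Relation.Nullary using (¬_)
open import Relation.Binary.PropositionalEquality using (_≡_; _≢_)
open import Function.Bundles using (_⇔_)

ThreeFree : (ℕ → Set) → Set
ThreeFree P = ∀ x y z → P x → P y → P z → x < y → y < z → x + z ≢ 2 * y

InPrefix : (ℕ → ℕ) → ℕ → ℕ → Set
InPrefix a n x = ∃[ i ] (i ≤ n × a i ≡ x)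

PrefixWith : (ℕ → ℕ) → ℕ → ℕ → ℕ → Set
PrefixWith a n x y = InPrefix a n y ⊎ y ≡ x

-- a is the Stanley sequence S(A) generated by the finite set A, where A is
-- given as its strictly increasing listing: A is a finite 3-free set of
-- nonnegative integers containing 0; a lists A in increasing order and then
-- each subsequent term is the least integer larger than the previous term
-- keeping the set 3-free.
IsStanleySeqOf : List ℕ → (ℕ → ℕ) → Set
IsStanleySeqOf A a =
  Linked _<_ A
  × 0 ∈ A
  × ThreeFree (λ x → x ∈ A)
  × (∀ i (p : i < length A) → a i ≡ lookup A (fromℕ< p))
  × (∀ n → length A ≤ suc n →
       (a n < a (suc n))
       × ThreeFree (PrefixWith a n (a (suc n)))
       × (∀ x → a n < x → x < a (suc n) → ¬ ThreeFree (PrefixWith a n x)))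

IsStanleySeq : (ℕ → ℕ) → Set
IsStanleySeq a = ∃[ A ] IsStanleySeqOf A a

-- a is independent with character λ' (λ' = λ ≥ 0 here; the equation
-- a(2^k) = 2 a(2^k - 1) - λ + 1 is written without subtraction).
IndependentWithCharacter : (ℕ → ℕ) → ℕ → Set
IndependentWithCharacter a lam =
  ∃[ χ ] ∀ k → χ ≤ k →
    (∀ i → i < 2 ^ k → a (2 ^ k + i) ≡ a (2 ^ k) + a i)
    × (a (2 ^ k) + lam ≡ 2 * a (2 ^ k ∸ 1) + 1)

subsetSum : (ℕ → ℕ) → (ℕ → Bool) → ℕ → ℕ
subsetSum b δ zero = 0
subsetSum b δ (suc n) = subsetSum b δ n + (if δ n then b n else 0)

IsBasis : (ℕ → ℕ) → (ℕ → ℕ) → Set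
IsBasis a b =
  (∃[ α ] ∃[ K ] ∀ k → K ≤ k → b k ≡ α * 3 ^ k)
  × (∀ x → (∃[ i ] a i ≡ x) ⇔ (∃[ n ] ∃[ δ ] x ≡ subsetSum b δ n))

IsBasic : (ℕ → ℕ) → Set
IsBasic a = ∃[ b ] IsBasis a b

-- Let x be prime to 3, D the set of numbers whose ternary digits are all 0 or 1, and
-- X = 3·D ∪ (x + 3·D), the set of subset sums of x, 3, 9, 27, ….  A 3-term AP in X lies
-- in one of the two layers (reduce mod 3), hence comes from one in D, which is trivial
-- because adding two elements of D never carries.  Conversely every y > 2x outside X ends
-- a 3-term AP in X: by y mod 3 it lies in 3·(ℕ ∖ D), in x + 3·(ℕ ∖ D) or in 2x + 3ℕ, and a
-- non-element of D is already blocked inside D.  So the increasing enumeration a of X is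
-- the Stanley sequence of its first 2x + 1 terms.  For k > x, X has 2^k elements below 3^k,
-- is invariant under y ↦ 3^k + y below 3^k, and its largest element below 3^k is
-- x + (3^k − 3)/2; hence a(2^k + i) = 3^k + a(i) and a(2^k) + (2x − 2) = 2 a(2^k − 1) + 1.
-- The character 2x − 2 runs through the λ ≡ 0, 2 (mod 6) as x runs through the numbers
-- prime to 3.
module Submission where

open import Defs
open import Data.Nat using (ℕ; _%_)
open import Data.Product using (∃-syntax; _×_)
open import Data.Sum using (_⊎_)
open import Relation.Binary.PropositionalEquality using (_≡_)

open import Level using (0ℓ)
open import Data.Bool using (Bool; true; false; if_then_else_)
open import Data.Empty using (⊥-elim)
open import Data.Fin using (fromℕ<)
open import Data.Fin.Properties using (toℕ-fromℕ<)
open import Data.List using (length; applyUpTo)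
open import Data.List.Properties using (length-applyUpTo; lookup-applyUpTo)
open import Data.List.Relation.Unary.Any using (here)
open import Data.List.Membership.Propositional using (_∈_)
open import Data.List.Membership.Propositional.Properties using (∈-applyUpTo⁻)
open import Data.List.Relation.Unary.Linked.Properties using (applyUpTo⁺₂)
open import Data.Nat using (zero; suc; _+_; _*_; _∸_; _^_; _≤_; _<_; z≤n; s≤s; _≤?_; _≟_; _/_)
open import Data.Nat.Properties
open import Data.Nat.DivMod using (m%n<n; [m+kn]%n≡m%n; m<n⇒m%n≡m; %-distribˡ-+; %-distribˡ-*; m≡m%n+[m/n]*n)
open import Data.Nat.Induction using (<-rec)
open import Data.Nat.Tactic.RingSolver using (solve-∀)
open import Data.Product using (Σ; ∃; ∃₂; _,_; proj₁; proj₂)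
open import Data.Product.Function.NonDependent.Propositional using (_×-⇔_)
open import Data.Sum using (inj₁; inj₂)
import Data.Sum as Sum
open import Function.Base using (_∘_)
open import Function.Bundles using (_⇔_; mk⇔; Equivalence)
open import Function.Construct.Composition using (_⇔-∘_)
open import Function.Construct.Identity using (⇔-id)
open import Function.Construct.Symmetry using (⇔-sym)
open import Relation.Nullary using (¬_; Dec; yes; no)
import Relation.Nullary.Decidable as Dec
open import Relation.Nullary.Decidable using (_×-dec_; _⊎-dec_)
open import Relation.Unary using (Pred; Decidable)
open import Relation.Binary.PropositionalEquality using (refl; sym; trans; cong; cong₂; subst; module ≡-Reasoning)

data Mod3View : ℕ → Set where
  rem0 : ∀ q → Mod3View (3 * q)
  rem1 : ∀ q → Mod3View (1 + 3 * q)
  rem2 : ∀ q → Mod3View (2 + 3 * q)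

mod3-view : ∀ n → Mod3View n
mod3-view zero = rem0 0
mod3-view (suc n) with mod3-view n
... | rem0 q = rem1 q
... | rem1 q = rem2 q
... | rem2 q = subst Mod3View (*-suc 3 q) (rem0 (suc q))

ternary-split : ∀ n → ∃₂ λ e q → e < 3 × n ≡ e + 3 * q
ternary-split n = n % 3 , n / 3 , m%n<n n 3 , trans (m≡m%n+[m/n]*n n 3) (cong (n % 3 +_) (*-comm (n / 3) 3))

[e+3q]%3≡e : ∀ {e} q → e < 3 → (e + 3 * q) % 3 ≡ e
[e+3q]%3≡e {e} q e<3 = begin
  (e + 3 * q) % 3 ≡⟨ cong (λ z → (e + z) % 3) (*-comm 3 q) ⟩
  (e + q * 3) % 3 ≡⟨ [m+kn]%n≡m%n e q 3 ⟩
  e % 3           ≡⟨ m<n⇒m%n≡m e<3 ⟩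
  e               ∎
  where open ≡-Reasoning

e+3q-injective : ∀ {e₁ e₂ q₁ q₂} → e₁ < 3 → e₂ < 3 → e₁ + 3 * q₁ ≡ e₂ + 3 * q₂ → e₁ ≡ e₂ × q₁ ≡ q₂
e+3q-injective {e₁} {e₂} {q₁} {q₂} e₁<3 e₂<3 eq = e₁≡e₂ , *-cancelˡ-≡ q₁ q₂ 3 (+-cancelˡ-≡ e₁ _ _ eq′)
  where
  e₁≡e₂ : e₁ ≡ e₂
  e₁≡e₂ = trans (sym ([e+3q]%3≡e q₁ e₁<3)) (trans (cong (_% 3) eq) ([e+3q]%3≡e q₂ e₂<3))
  eq′ : e₁ + 3 * q₁ ≡ e₁ + 3 * q₂
  eq′ = trans eq (cong (_+ 3 * q₂) (sym e₁≡e₂))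

q<e+3q : ∀ e q → 0 < e + 3 * q → q < e + 3 * q
q<e+3q e zero pos = pos
q<e+3q e (suc q) _ =
  <-≤-trans (m<m+n (suc q) (s≤s z≤n)) (≤-trans (+-monoʳ-≤ (suc q) (m≤m+n (suc q) _)) (m≤n+m (3 * suc q) e))

e+3q<3^suc⇒q<3^ : ∀ j e {q} → e + 3 * q < 3 ^ suc j → q < 3 ^ j
e+3q<3^suc⇒q<3^ j e {q} lt = *-cancelˡ-< 3 q (3 ^ j) (≤-<-trans (m≤n+m (3 * q) e) lt)

e+3q≡e+3c+3[q∸c] : ∀ e c q → e + 3 * c ≤ e + 3 * q → e + 3 * q ≡ (e + 3 * c) + 3 * (q ∸ c)
e+3q≡e+3c+3[q∸c] e c q le = begin
  e + 3 * q             ≡⟨ cong (λ m → e + 3 * m) (sym (m+[n∸m]≡n c≤q)) ⟩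
  e + 3 * (c + (q ∸ c)) ≡⟨ regroup e c (q ∸ c) ⟩
  (e + 3 * c) + 3 * (q ∸ c) ∎
  where
  open ≡-Reasoning
  c≤q : c ≤ q
  c≤q = *-cancelˡ-≤ 3 (+-cancelˡ-≤ e _ _ le)
  regroup : ∀ e c m → e + 3 * (c + m) ≡ (e + 3 * c) + 3 * m
  regroup = solve-∀

ap-%3 : ∀ {u v w} → u + w ≡ 2 * v → (u % 3 + w % 3) % 3 ≡ (2 * (v % 3)) % 3
ap-%3 {u} {v} {w} eq = trans (sym (%-distribˡ-+ u w 3)) (trans (cong (_% 3) eq) (%-distribˡ-* 2 v 3))

3*-offset-ap⇔ : ∀ k a b c → ((k + 3 * a) + (k + 3 * c) ≡ 2 * (k + 3 * b)) ⇔ (a + c ≡ 2 * b)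
3*-offset-ap⇔ k a b c = mk⇔
  (λ eq → *-cancelˡ-≡ _ _ 3 (+-cancelˡ-≡ (2 * k) _ _ (trans (sym (expand k a c)) (trans eq (collect k b)))))
  (λ eq → trans (expand k a c) (trans (cong (λ m → 2 * k + 3 * m) eq) (sym (collect k b))))
  where
  expand : ∀ k a c → (k + 3 * a) + (k + 3 * c) ≡ 2 * k + 3 * (a + c)
  expand = solve-∀
  collect : ∀ k b → 2 * (k + 3 * b) ≡ 2 * k + 3 * (2 * b)
  collect = solve-∀

Blocked : Pred ℕ 0ℓ → ℕ → Set
Blocked P y = ∃₂ λ u v → P u × P v × u < v × v < y × u + y ≡ 2 * v

blocked⇒∉ : ∀ {P y} → ThreeFree P → Blocked P y → ¬ P y
blocked⇒∉ {y = y} free (u , v , pu , pv , u<v , v<y , eq) py = free u v y pu pv py u<v v<y eq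

EndsAP : Pred ℕ 0ℓ → ℕ → Set
EndsAP P q = ∃₂ λ a b → P a × P b × a ≤ b × b ≤ q × a + q ≡ 2 * b

∈⊎blocked⇒endsAP : ∀ {P q} → P q ⊎ Blocked P q → EndsAP P q
∈⊎blocked⇒endsAP {q = q} (inj₁ pq) = q , q , pq , pq , ≤-refl , ≤-refl , sym (2*q≡q+q q)
  where
  2*q≡q+q : ∀ q → 2 * q ≡ q + q
  2*q≡q+q = solve-∀
∈⊎blocked⇒endsAP (inj₂ (u , v , pu , pv , u<v , v<q , eq)) = u , v , pu , pv , <⇒≤ u<v , <⇒≤ v<q , eq

blocked-3* : ∀ {P Q : Pred ℕ 0ℓ} k {q} → (∀ {z} → P z → Q (k + 3 * z)) → Blocked P q → Blocked Q (k + 3 * q)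
blocked-3* k {q} f (u , v , pu , pv , u<v , v<q , eq) =
  k + 3 * u , k + 3 * v , f pu , f pv , +-monoʳ-< k (*-monoʳ-< 3 u<v) , +-monoʳ-< k (*-monoʳ-< 3 v<q) ,
  Equivalence.from (3*-offset-ap⇔ k u v q) eq

endsAP⇒blocked : ∀ {P Q : Pred ℕ 0ℓ} k {q} → 0 < k → (∀ {z} → P z → Q (3 * z)) → (∀ {z} → P z → Q (k + 3 * z)) →
  EndsAP P q → Blocked Q (2 * k + 3 * q)
endsAP⇒blocked k {q} k>0 f g (a , b , pa , pb , a≤b , b≤q , eq) =
  3 * a , k + 3 * b , f pa , g pb ,
  ≤-<-trans (*-monoʳ-≤ 3 a≤b) (m<n+m (3 * b) k>0) ,
  ≤-<-trans (+-monoʳ-≤ k (*-monoʳ-≤ 3 b≤q)) (<-≤-trans (m<n+m (k + 3 * q) k>0) (≤-reflexive (sym (split k q)))) ,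
  trans (expand k a q) (trans (cong (λ s → 2 * k + 3 * s) eq) (collect k b))
  where
  split : ∀ k q → 2 * k + 3 * q ≡ k + (k + 3 * q)
  split = solve-∀
  expand : ∀ k a q → 3 * a + (2 * k + 3 * q) ≡ 2 * k + 3 * (a + q)
  expand = solve-∀
  collect : ∀ k b → 2 * k + 3 * (2 * b) ≡ 2 * (k + 3 * b)
  collect = solve-∀


-- Numbers with ternary digits 0 and 1

data Digits01 : ℕ → Set where
  []  : Digits01 0
  _∷_ : ∀ {e n} → e ≤ 1 → Digits01 n → Digits01 (e + 3 * n)

digits01-uncons : ∀ {z} → Digits01 z → ∃₂ λ e n → e ≤ 1 × Digits01 n × z ≡ e + 3 * n
digits01-uncons []                 = 0 , 0 , z≤n , [] , refl
digits01-uncons (_∷_ {e} {n} e≤1 d) = e , n , e≤1 , d , refl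

≤1⇒<3 : ∀ {e} → e ≤ 1 → e < 3
≤1⇒<3 e≤1 = ≤-trans (s≤s e≤1) (s≤s (s≤s z≤n))

digits01-∷⁻ : ∀ {e n} → e < 3 → Digits01 (e + 3 * n) → e ≤ 1 × Digits01 n
digits01-∷⁻ {n = n} e<3 d with digits01-uncons d
... | e′ , n′ , e′≤1 , d′ , eq with e+3q-injective {q₁ = n} {q₂ = n′} e<3 (≤1⇒<3 e′≤1) eq
...   | refl , refl = e′≤1 , d′

digits01-∷-⇔-tail : ∀ {e n} → e ≤ 1 → Digits01 (e + 3 * n) ⇔ Digits01 n
digits01-∷-⇔-tail {e} {n} e≤1 = mk⇔ (λ d → proj₂ (digits01-∷⁻ {e} {n} (≤1⇒<3 e≤1) d)) (e≤1 ∷_)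

digits01-2+3*-∉ : ∀ n → ¬ Digits01 (2 + 3 * n)
digits01-2+3*-∉ n d with digits01-∷⁻ {2} {n} (s≤s (s≤s (s≤s z≤n))) d
... | s≤s () , _

ap-of-bits : ∀ {a b c} → a ≤ 1 → b ≤ 1 → c ≤ 1 → a + c ≡ 2 * b → a ≡ b
ap-of-bits z≤n       z≤n       _         _  = refl
ap-of-bits z≤n       (s≤s z≤n) z≤n       ()
ap-of-bits z≤n       (s≤s z≤n) (s≤s z≤n) ()
ap-of-bits (s≤s z≤n) z≤n       _         ()
ap-of-bits (s≤s z≤n) (s≤s z≤n) _         _  = refl

2*bit<3 : ∀ {e} → e ≤ 1 → 2 * e < 3
2*bit<3 z≤n       = s≤s z≤n
2*bit<3 (s≤s z≤n) = s≤s (s≤s (s≤s z≤n))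

ap-digitwise : ∀ {ea eb ec a b c} → ea + ec < 3 → 2 * eb < 3 →
  (ea + 3 * a) + (ec + 3 * c) ≡ 2 * (eb + 3 * b) → ea + ec ≡ 2 * eb × a + c ≡ 2 * b
ap-digitwise {ea} {eb} {ec} {a} {b} {c} low<3 2eb<3 eq =
  e+3q-injective low<3 2eb<3 (trans (regroup ea a ec c) (trans eq (double eb b)))
  where
  regroup : ∀ ea a ec c → (ea + ec) + 3 * (a + c) ≡ (ea + 3 * a) + (ec + 3 * c)
  regroup = solve-∀
  double : ∀ eb b → 2 * (eb + 3 * b) ≡ 2 * eb + 3 * (2 * b)
  double = solve-∀

-- Digits 0/1 never carry, so a 3-term AP of such numbers is an AP digit by digit.
digits01-ap-trivial : ∀ {a b c} → Digits01 a → Digits01 b → Digits01 c → a + c ≡ 2 * b → a ≡ b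
digits01-ap-trivial {a} da [] dc eq = m+n≡0⇒m≡0 a eq
digits01-ap-trivial da (_∷_ {eb} {b} eb≤1 db) dc eq with digits01-uncons da | digits01-uncons dc
... | ea , a , ea≤1 , da′ , refl | ec , c , ec≤1 , dc′ , refl
  with ap-digitwise {ea} {eb} {ec} {a} {b} {c} (s≤s (+-mono-≤ ea≤1 ec≤1)) (2*bit<3 eb≤1) eq
...   | low , high = cong₂ (λ e n → e + 3 * n) (ap-of-bits ea≤1 eb≤1 ec≤1 low) (digits01-ap-trivial da′ db dc′ high)

digits01-threeFree : ThreeFree Digits01
digits01-threeFree a b c da db dc a<b _ eq = <-irrefl (digits01-ap-trivial da db dc eq) a<b

-- A last digit 2 is always blocked: any AP a, b, q′ in D gives the AP 3a, 1 + 3b, 2 + 3q′.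
digits01⊎blocked : ∀ q → Digits01 q ⊎ Blocked Digits01 q
digits01⊎blocked = <-rec _ step
  where
  step : ∀ q → (∀ {q′} → q′ < q → Digits01 q′ ⊎ Blocked Digits01 q′) → Digits01 q ⊎ Blocked Digits01 q
  step q rec with mod3-view q
  ... | rem0 zero     = inj₁ []
  ... | rem0 (suc q′) = Sum.map (z≤n ∷_) (blocked-3* 0 (z≤n ∷_)) (rec (q<e+3q 0 (suc q′) (s≤s z≤n)))
  ... | rem1 q′       = Sum.map (s≤s z≤n ∷_) (blocked-3* 1 (s≤s z≤n ∷_)) (rec (q<e+3q 1 q′ (s≤s z≤n)))
  ... | rem2 q′       =
    inj₂ (endsAP⇒blocked 1 (s≤s z≤n) (z≤n ∷_) (s≤s z≤n ∷_) (∈⊎blocked⇒endsAP (rec (q<e+3q 2 q′ (s≤s z≤n)))))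

digits01? : Decidable Digits01
digits01? q with digits01⊎blocked q
... | inj₁ d       = yes d
... | inj₂ blocked = no (blocked⇒∉ digits01-threeFree blocked)

allOnes : ℕ → ℕ
allOnes zero    = 0
allOnes (suc j) = 1 + 3 * allOnes j

1+2*allOnes≡3^ : ∀ j → 1 + 2 * allOnes j ≡ 3 ^ j
1+2*allOnes≡3^ zero    = refl
1+2*allOnes≡3^ (suc j) = trans (shift (allOnes j)) (cong (3 *_) (1+2*allOnes≡3^ j))
  where
  shift : ∀ v → 1 + 2 * (1 + 3 * v) ≡ 3 * (1 + 2 * v)
  shift = solve-∀

n≤allOnes : ∀ n → n ≤ allOnes n
n≤allOnes zero    = z≤n
n≤allOnes (suc n) = s≤s (≤-trans (n≤allOnes n) (m≤n*m (allOnes n) 3))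

n<3^n : ∀ n → n < 3 ^ n
n<3^n n = <-≤-trans (s≤s (≤-trans (n≤allOnes n) (m≤n*m (allOnes n) 2))) (≤-reflexive (1+2*allOnes≡3^ n))

digits01-allOnes : ∀ j → Digits01 (allOnes j)
digits01-allOnes zero    = []
digits01-allOnes (suc j) = s≤s z≤n ∷ digits01-allOnes j

digits01⇒≤allOnes : ∀ j {d} → Digits01 d → d < 3 ^ j → d ≤ allOnes j
digits01⇒≤allOnes zero    _  (s≤s d≤0) = d≤0
digits01⇒≤allOnes (suc j) dd lt with digits01-uncons dd
... | e , n , e≤1 , dn , refl = +-mono-≤ e≤1 (*-monoʳ-≤ 3 (digits01⇒≤allOnes j dn (e+3q<3^suc⇒q<3^ j e lt)))

digits01-3^ : ∀ m → Digits01 (3 ^ m)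
digits01-3^ zero    = s≤s z≤n ∷ []
digits01-3^ (suc m) = z≤n ∷ digits01-3^ m

digits01-∷-⇔ : ∀ {e a b} → e < 3 → (Digits01 a ⇔ Digits01 b) → Digits01 (e + 3 * a) ⇔ Digits01 (e + 3 * b)
digits01-∷-⇔ {e} {a} {b} e<3 a⇔b = mk⇔ (move (Equivalence.to a⇔b)) (move (Equivalence.from a⇔b))
  where
  move : ∀ {a b} → (Digits01 a → Digits01 b) → Digits01 (e + 3 * a) → Digits01 (e + 3 * b)
  move {a} f d = let e≤1 , d′ = digits01-∷⁻ {e} {a} e<3 d in e≤1 ∷ f d′

3^+e+3q≡e+3[3^+q] : ∀ j e q → 3 ^ suc j + (e + 3 * q) ≡ e + 3 * (3 ^ j + q)
3^+e+3q≡e+3[3^+q] j e q = lemma (3 ^ j) e q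
  where
  lemma : ∀ p e q → 3 * p + (e + 3 * q) ≡ e + 3 * (p + q)
  lemma = solve-∀

digits01-3^+ : ∀ j {y} → y < 3 ^ j → Digits01 (3 ^ j + y) ⇔ Digits01 y
digits01-3^+ zero    {zero}  _           = mk⇔ (λ _ → []) (λ _ → s≤s z≤n ∷ [])
digits01-3^+ zero    {suc _} (s≤s ())
digits01-3^+ (suc j) {y} lt with ternary-split y
... | e , q , e<3 , refl = subst (λ z → Digits01 z ⇔ Digits01 (e + 3 * q)) (sym (3^+e+3q≡e+3[3^+q] j e q))
  (digits01-∷-⇔ e<3 (digits01-3^+ j (e+3q<3^suc⇒q<3^ j e lt)))


-- Counting

indicator : ∀ {A : Set} → Dec A → ℕ
indicator (yes _) = 1
indicator (no _)  = 0

indicator-yes : ∀ {A : Set} (a? : Dec A) → A → indicator a? ≡ 1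
indicator-yes (yes _) _ = refl
indicator-yes (no ¬a) a = ⊥-elim (¬a a)

indicator-no : ∀ {A : Set} (a? : Dec A) → ¬ A → indicator a? ≡ 0
indicator-no (yes a) ¬a = ⊥-elim (¬a a)
indicator-no (no _)  _  = refl

indicator-⇔ : ∀ {A B : Set} (a? : Dec A) (b? : Dec B) → A ⇔ B → indicator a? ≡ indicator b?
indicator-⇔ (yes _) (yes _) _   = refl
indicator-⇔ (yes a) (no ¬b) a⇔b = ⊥-elim (¬b (Equivalence.to a⇔b a))
indicator-⇔ (no ¬a) (yes b) a⇔b = ⊥-elim (¬a (Equivalence.from a⇔b b))
indicator-⇔ (no _)  (no _)  _   = refl

indicator-⊎ : ∀ {A B C : Set} (a? : Dec A) (b? : Dec B) (c? : Dec C) → (A ⇔ (B ⊎ C)) → ¬ (B × C) →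
  indicator a? ≡ indicator b? + indicator c?
indicator-⊎ a? (yes b) (yes c) _ disjoint = ⊥-elim (disjoint (b , c))
indicator-⊎ a? (yes b) (no _)  a⇔b⊎c _ = indicator-yes a? (Equivalence.from a⇔b⊎c (inj₁ b))
indicator-⊎ a? (no _)  (yes c) a⇔b⊎c _ = indicator-yes a? (Equivalence.from a⇔b⊎c (inj₂ c))
indicator-⊎ a? (no ¬b) (no ¬c) a⇔b⊎c _ = indicator-no a? (Sum.[ ¬b , ¬c ] ∘ Equivalence.to a⇔b⊎c)

count : ∀ {P : Pred ℕ 0ℓ} → Decidable P → ℕ → ℕ
count P? zero    = 0
count P? (suc n) = count P? n + indicator (P? n)

module _ {P : Pred ℕ 0ℓ} (P? : Decidable P) where

  count-skip : ∀ m d → (∀ z → m ≤ z → z < m + d → ¬ P z) → count P? (m + d) ≡ count P? m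
  count-skip m zero    _     = cong (count P?) (+-identityʳ m)
  count-skip m (suc d) empty = begin
    count P? (m + suc d)                      ≡⟨ cong (count P?) (+-suc m d) ⟩
    count P? (m + d) + indicator (P? (m + d)) ≡⟨ cong₂ _+_ (count-skip m d (λ z m≤z z<m+d → empty z m≤z (extend z<m+d)))
                                                           (indicator-no (P? (m + d)) (empty (m + d) (m≤m+n m d) m+d<m+suc-d)) ⟩
    count P? m + 0                            ≡⟨ +-identityʳ _ ⟩
    count P? m                                ∎
    where
    open ≡-Reasoning
    extend : ∀ {z} → z < m + d → z < m + suc d
    extend {z} z<m+d = subst (z <_) (sym (+-suc m d)) (m<n⇒m<1+n z<m+d)
    m+d<m+suc-d : m + d < m + suc d
    m+d<m+suc-d = +-monoʳ-< m (n<1+n d)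

  count-+ : ∀ {Q : Pred ℕ 0ℓ} (Q? : Decidable Q) s n → (∀ y → y < n → P (s + y) ⇔ Q y) →
    count P? (s + n) ≡ count P? s + count Q? n
  count-+ Q? s zero    _     = trans (cong (count P?) (+-identityʳ s)) (sym (+-identityʳ _))
  count-+ Q? s (suc n) shift = begin
    count P? (s + suc n)                        ≡⟨ cong (count P?) (+-suc s n) ⟩
    count P? (s + n) + indicator (P? (s + n))   ≡⟨ cong₂ _+_ (count-+ Q? s n (λ y y<n → shift y (m<n⇒m<1+n y<n)))
                                                              (indicator-⇔ (P? (s + n)) (Q? n) (shift n ≤-refl)) ⟩
    (count P? s + count Q? n) + indicator (Q? n) ≡⟨ +-assoc (count P? s) _ _ ⟩
    count P? s + count Q? (suc n)               ∎
    where open ≡-Reasoning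

  count-⊎ : ∀ {Q R : Pred ℕ 0ℓ} (Q? : Decidable Q) (R? : Decidable R) → (∀ z → P z ⇔ (Q z ⊎ R z)) →
    (∀ z → ¬ (Q z × R z)) → ∀ n → count P? n ≡ count Q? n + count R? n
  count-⊎ Q? R? split disjoint zero    = refl
  count-⊎ Q? R? split disjoint (suc n) =
    trans (cong₂ _+_ (count-⊎ Q? R? split disjoint n) (indicator-⊎ (P? n) (Q? n) (R? n) (split n) (disjoint n)))
          (interchange (count Q? n) (count R? n) _ _)
    where
    interchange : ∀ a b c d → (a + b) + (c + d) ≡ (a + c) + (b + d)
    interchange = solve-∀

  count-3* : ∀ k {Q : Pred ℕ 0ℓ} (Q? : Decidable Q) →
    (∀ n → indicator (P? (3 * n)) + indicator (P? (1 + 3 * n)) + indicator (P? (2 + 3 * n)) ≡ k * indicator (Q? n)) →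
    ∀ n → count P? (3 * n) ≡ k * count Q? n
  count-3* k Q? block zero    = sym (*-zeroʳ k)
  count-3* k Q? block (suc n) = begin
    count P? (3 * suc n)                                            ≡⟨ cong (count P?) (*-suc 3 n) ⟩
    count P? (3 * n) + i₀ + i₁ + i₂                                  ≡⟨ regroup (count P? (3 * n)) i₀ i₁ i₂ ⟩
    count P? (3 * n) + (i₀ + i₁ + i₂)                                ≡⟨ cong₂ _+_ (count-3* k Q? block n) (block n) ⟩
    k * count Q? n + k * indicator (Q? n)                            ≡⟨ sym (*-distribˡ-+ k (count Q? n) _) ⟩
    k * count Q? (suc n)                                             ∎
    where
    open ≡-Reasoning
    i₀ = indicator (P? (3 * n))
    i₁ = indicator (P? (1 + 3 * n))
    i₂ = indicator (P? (2 + 3 * n))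
    regroup : ∀ c a b d → c + a + b + d ≡ c + (a + b + d)
    regroup = solve-∀

count-digits01-3^ : ∀ j → count digits01? (3 ^ j) ≡ 2 ^ j
count-digits01-3^ zero    = indicator-yes (digits01? 0) []
count-digits01-3^ (suc j) = trans (count-3* digits01? 2 digits01? blocks (3 ^ j)) (cong (2 *_) (count-digits01-3^ j))
  where
  blocks : ∀ n → indicator (digits01? (3 * n)) + indicator (digits01? (1 + 3 * n)) + indicator (digits01? (2 + 3 * n))
                 ≡ 2 * indicator (digits01? n)
  blocks n = begin
    _ ≡⟨ cong₂ _+_ (cong₂ _+_ (indicator-⇔ (digits01? (3 * n)) (digits01? n) (digits01-∷-⇔-tail z≤n))
                              (indicator-⇔ (digits01? (1 + 3 * n)) (digits01? n) (digits01-∷-⇔-tail (s≤s z≤n))))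
                   (indicator-no (digits01? (2 + 3 * n)) (digits01-2+3*-∉ n)) ⟩
    i + i + 0 ≡⟨ i+i+0≡2*i i ⟩
    2 * i     ∎
    where
    open ≡-Reasoning
    i = indicator (digits01? n)
    i+i+0≡2*i : ∀ i → i + i + 0 ≡ 2 * i
    i+i+0≡2*i = solve-∀


-- Increasing enumeration of an infinite decidable set

module Enumeration {P : Pred ℕ 0ℓ} (P? : Decidable P) (P0 : P 0) (unbounded : ∀ m → ∃ λ y → m < y × P y) where

  private
    least-≥ : ∀ m f → P (f + m) → ∃ λ y → m ≤ y × P y × (∀ z → m ≤ z → z < y → ¬ P z)
    least-≥ m zero    pm = m , ≤-refl , pm , λ _ m≤z z<m → ⊥-elim (≤⇒≯ m≤z z<m)
    least-≥ m (suc f) pf with P? m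
    ... | yes pm = m , ≤-refl , pm , λ _ m≤z z<m → ⊥-elim (≤⇒≯ m≤z z<m)
    ... | no ¬pm with least-≥ (suc m) f (subst P (sym (+-suc f m)) pf)
    ...   | y , m<y , py , below = y , <⇒≤ m<y , py , below′
      where
      below′ : ∀ z → m ≤ z → z < y → ¬ P z
      below′ z m≤z z<y with m≤n⇒m<n∨m≡n m≤z
      ... | inj₁ m<z = below z m<z z<y
      ... | inj₂ refl = ¬pm

    next : ∀ m → ∃ λ y → m < y × P y × (∀ z → m < z → z < y → ¬ P z)
    next m with unbounded m
    ... | b , m<b , pb = least-≥ (suc m) (b ∸ suc m) (subst P (sym (m∸n+n≡m m<b)) pb)

  enum : ℕ → ℕ
  enum zero    = 0
  enum (suc n) = proj₁ (next (enum n))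

  enum-∈ : ∀ n → P (enum n)
  enum-∈ zero    = P0
  enum-∈ (suc n) = proj₁ (proj₂ (proj₂ (next (enum n))))

  enum-<-suc : ∀ n → enum n < enum (suc n)
  enum-<-suc n = proj₁ (proj₂ (next (enum n)))

  enum-gap : ∀ n z → enum n < z → z < enum (suc n) → ¬ P z
  enum-gap n = proj₂ (proj₂ (proj₂ (next (enum n))))

  enum-strictMono : ∀ {i j} → i < j → enum i < enum j
  enum-strictMono {i} {suc j} (s≤s i≤j) with m≤n⇒m<n∨m≡n i≤j
  ... | inj₁ i<j  = <-trans (enum-strictMono i<j) (enum-<-suc j)
  ... | inj₂ refl = enum-<-suc i

  enum-mono : ∀ {i j} → i ≤ j → enum i ≤ enum j
  enum-mono i≤j with m≤n⇒m<n∨m≡n i≤j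
  ... | inj₁ i<j  = <⇒≤ (enum-strictMono i<j)
  ... | inj₂ refl = ≤-refl

  n≤enum : ∀ n → n ≤ enum n
  n≤enum zero    = z≤n
  n≤enum (suc n) = ≤-<-trans (n≤enum n) (enum-<-suc n)

  count-enum : ∀ n → count P? (enum n) ≡ n
  count-enum zero    = refl
  count-enum (suc n) = begin
    count P? (enum (suc n))                                 ≡⟨ cong (count P?) (sym (m+[n∸m]≡n (enum-<-suc n))) ⟩
    count P? (suc (enum n) + (enum (suc n) ∸ suc (enum n))) ≡⟨ count-skip P? (suc (enum n)) _ gap ⟩
    count P? (enum n) + indicator (P? (enum n))             ≡⟨ cong₂ _+_ (count-enum n) (indicator-yes (P? (enum n)) (enum-∈ n)) ⟩
    n + 1                                                   ≡⟨ +-comm n 1 ⟩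
    suc n                                                   ∎
    where
    open ≡-Reasoning
    gap : ∀ z → suc (enum n) ≤ z → z < suc (enum n) + (enum (suc n) ∸ suc (enum n)) → ¬ P z
    gap z n<z z<end = enum-gap n z n<z (subst (z <_) (m+[n∸m]≡n (enum-<-suc n)) z<end)

  enum-bracket : ∀ y → ∃ λ n → enum n ≤ y × y < enum (suc n)
  enum-bracket zero = 0 , z≤n , enum-<-suc 0
  enum-bracket (suc y) with enum-bracket y
  ... | n , lo , hi with m≤n⇒m<n∨m≡n hi
  ...   | inj₁ sy<next = n , m≤n⇒m≤1+n lo , sy<next
  ...   | inj₂ sy≡next =
    suc n , ≤-reflexive (sym sy≡next) , subst (_< enum (suc (suc n))) (sym sy≡next) (enum-<-suc (suc n))

  enum-count : ∀ {y} → P y → enum (count P? y) ≡ y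
  enum-count {y} py with enum-bracket y
  ... | n , lo , hi with m≤n⇒m<n∨m≡n lo
  ...   | inj₁ lo< = ⊥-elim (enum-gap n y lo< hi py)
  ...   | inj₂ refl = cong enum (count-enum n)

  ∈⇒inPrefix : ∀ {y n} → P y → y < enum (suc n) → InPrefix enum n y
  ∈⇒inPrefix {y} {n} py y<next = count P? y , index≤n , enum-count py
    where
    index≤n : count P? y ≤ n
    index≤n with count P? y ≤? n
    ... | yes ≤n = ≤n
    ... | no ≰n = ⊥-elim (<⇒≱ y<next (subst (enum (suc n) ≤_) (enum-count py) (enum-mono (≰⇒> ≰n))))

  enum-+ : ∀ n → (∀ y → y < enum n → P (enum n + y) ⇔ P y) → ∀ i → i < n → enum (n + i) ≡ enum n + enum i
  enum-+ n translate i i<n = begin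
    enum (n + i)                                 ≡⟨ cong enum (sym (cong₂ _+_ (count-enum n) (count-enum i))) ⟩
    enum (count P? (enum n) + count P? (enum i)) ≡⟨ cong enum (sym (count-+ P? P? (enum n) (enum i) translate′)) ⟩
    enum (count P? (enum n + enum i))            ≡⟨ enum-count (Equivalence.from (translate (enum i) i<n′) (enum-∈ i)) ⟩
    enum n + enum i                              ∎
    where
    open ≡-Reasoning
    i<n′ : enum i < enum n
    i<n′ = enum-strictMono i<n
    translate′ : ∀ y → y < enum i → P (enum n + y) ⇔ P y
    translate′ y y<i = translate y (<-trans y<i i<n′)

  enum-last-below : ∀ n {y} → P y → y < enum n → (∀ z → y < z → z < enum n → ¬ P z) → enum (n ∸ 1) ≡ y
  enum-last-below n {y} py y<n empty = begin
    enum (n ∸ 1)                                   ≡⟨ cong (λ m → enum (m ∸ 1)) (sym (count-enum n)) ⟩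
    enum (count P? (enum n) ∸ 1)                   ≡⟨ cong (λ m → enum (count P? m ∸ 1)) (sym (m+[n∸m]≡n y<n)) ⟩
    enum (count P? (suc y + (enum n ∸ suc y)) ∸ 1) ≡⟨ cong (λ c → enum (c ∸ 1)) (count-skip P? (suc y) _ gap) ⟩
    enum (count P? y + indicator (P? y) ∸ 1)       ≡⟨ cong (λ i → enum (count P? y + i ∸ 1)) (indicator-yes (P? y) py) ⟩
    enum (count P? y + 1 ∸ 1)                      ≡⟨ cong enum (m+n∸n≡m (count P? y) 1) ⟩
    enum (count P? y)                              ≡⟨ enum-count py ⟩
    y                                              ∎
    where
    open ≡-Reasoning
    gap : ∀ z → suc y ≤ z → z < suc y + (enum n ∸ suc y) → ¬ P z
    gap z y<z z<end = empty z y<z (subst (z <_) (m+[n∸m]≡n y<n) z<end)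

  isStanleySeqOf : ThreeFree P → ∀ N → (∀ y → ¬ P y → N < y → Blocked P y) →
    IsStanleySeqOf (applyUpTo enum (suc N)) enum
  isStanleySeqOf free N blocked =
    applyUpTo⁺₂ enum (suc N) enum-<-suc ,
    here refl ,
    (λ u v w mu mv mw → free u v w (initial mu) (initial mv) (initial mw)) ,
    (λ i p → sym (trans (lookup-applyUpTo enum (suc N) (fromℕ< p)) (cong enum (toℕ-fromℕ< p)))) ,
    greedy
    where
    initial : ∀ {v} → v ∈ applyUpTo enum (suc N) → P v
    initial mv with ∈-applyUpTo⁻ enum mv
    ... | i , _ , refl = enum-∈ i
    greedy : ∀ n → length (applyUpTo enum (suc N)) ≤ suc n →
      (enum n < enum (suc n)) × ThreeFree (PrefixWith enum n (enum (suc n)))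
      × (∀ y → enum n < y → y < enum (suc n) → ¬ ThreeFree (PrefixWith enum n y))
    greedy n len≤ = enum-<-suc n , (λ u v w pu pv pw → free u v w (prefix-∈ pu) (prefix-∈ pv) (prefix-∈ pw)) , forced
      where
      N≤n : N ≤ n
      N≤n = ≤-pred (subst (_≤ suc n) (length-applyUpTo enum (suc N)) len≤)
      prefix-∈ : ∀ {z} → PrefixWith enum n (enum (suc n)) z → P z
      prefix-∈ (inj₁ (i , _ , refl)) = enum-∈ i
      prefix-∈ (inj₂ refl)           = enum-∈ (suc n)
      forced : ∀ y → enum n < y → y < enum (suc n) → ¬ ThreeFree (PrefixWith enum n y)
      forced y lo hi prefix-free with blocked y (enum-gap n y lo hi) (≤-<-trans (≤-trans N≤n (n≤enum n)) lo)
      ... | u , v , pu , pv , u<v , v<y , eq =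
        prefix-free u v y (inj₁ (∈⇒inPrefix pu (<-trans u<v (<-trans v<y hi)))) (inj₁ (∈⇒inPrefix pv (<-trans v<y hi)))
                    (inj₂ refl) u<v v<y eq


-- Subset sums

subsetSum-uncons : ∀ b δ n → subsetSum b δ (suc n) ≡ (if δ 0 then b 0 else 0) + subsetSum (b ∘ suc) (δ ∘ suc) n
subsetSum-uncons b δ zero    = +-comm 0 _
subsetSum-uncons b δ (suc n) =
  trans (cong (_+ (if δ (suc n) then b (suc n) else 0)) (subsetSum-uncons b δ n)) (+-assoc (if δ 0 then b 0 else 0) _ _)

subsetSum-3* : ∀ b δ n → subsetSum (λ k → 3 * b k) δ n ≡ 3 * subsetSum b δ n
subsetSum-3* b δ zero    = refl
subsetSum-3* b δ (suc n) =
  trans (cong₂ _+_ (subsetSum-3* b δ n) (if-3* (δ n))) (sym (*-distribˡ-+ 3 (subsetSum b δ n) _))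
  where
  if-3* : ∀ c → (if c then 3 * b n else 0) ≡ 3 * (if c then b n else 0)
  if-3* true  = refl
  if-3* false = refl

subsetSum-3^-uncons : ∀ δ n → subsetSum (3 ^_) δ (suc n) ≡ (if δ 0 then 1 else 0) + 3 * subsetSum (3 ^_) (δ ∘ suc) n
subsetSum-3^-uncons δ n = trans (subsetSum-uncons (3 ^_) δ n) (cong (_ +_) (subsetSum-3* (3 ^_) (δ ∘ suc) n))

bit≤1 : ∀ c → (if c then 1 else 0) ≤ 1
bit≤1 true  = s≤s z≤n
bit≤1 false = z≤n

digits01-subsetSum-3^ : ∀ δ n → Digits01 (subsetSum (3 ^_) δ n)
digits01-subsetSum-3^ δ zero    = []
digits01-subsetSum-3^ δ (suc n) =
  subst Digits01 (sym (subsetSum-3^-uncons δ n)) (bit≤1 (δ 0) ∷ digits01-subsetSum-3^ (δ ∘ suc) n)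

prepend : Bool → (ℕ → Bool) → ℕ → Bool
prepend c δ zero    = c
prepend c δ (suc k) = δ k

bit-of : ∀ {e} → e ≤ 1 → ∃ λ c → (if c then 1 else 0) ≡ e
bit-of z≤n       = false , refl
bit-of (s≤s z≤n) = true , refl

digits01⇒subsetSum-3^ : ∀ {d} → Digits01 d → ∃₂ λ n δ → d ≡ subsetSum (3 ^_) δ n
digits01⇒subsetSum-3^ []        = 0 , (λ _ → false) , refl
digits01⇒subsetSum-3^ (e≤1 ∷ d) with bit-of e≤1 | digits01⇒subsetSum-3^ d
... | c , refl | n , δ , refl = suc n , prepend c δ , sym (subsetSum-3^-uncons (prepend c δ) n)

data NonZeroDigit : ℕ → Set where
  one : NonZeroDigit 1
  two : NonZeroDigit 2

nonZeroDigit-< : ∀ {r} → NonZeroDigit r → r < 3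
nonZeroDigit-< one = s≤s (s≤s z≤n)
nonZeroDigit-< two = s≤s (s≤s (s≤s z≤n))

nonZeroDigit-> : ∀ {r} → NonZeroDigit r → 0 < r
nonZeroDigit-> one = s≤s z≤n
nonZeroDigit-> two = s≤s z≤n

nonZeroDigit-≡⊎≡3∸ : ∀ {r e} → NonZeroDigit r → NonZeroDigit e → e ≡ r ⊎ e ≡ 3 ∸ r
nonZeroDigit-≡⊎≡3∸ one one = inj₁ refl
nonZeroDigit-≡⊎≡3∸ one two = inj₂ refl
nonZeroDigit-≡⊎≡3∸ two one = inj₂ refl
nonZeroDigit-≡⊎≡3∸ two two = inj₁ refl

double-r+3t : ∀ {r} → NonZeroDigit r → ∀ t → 2 * (r + 3 * t) ≡ (3 ∸ r) + 3 * (2 * t + (r ∸ 1))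
double-r+3t one = solve-∀
double-r+3t two = solve-∀

residue : ℕ → Bool → ℕ
residue r s = if s then r else 0

residues-ap : ∀ {r} → NonZeroDigit r → ∀ s₁ s₂ s₃ →
  (residue r s₁ + residue r s₃) % 3 ≡ (2 * residue r s₂) % 3 → s₁ ≡ s₂ × s₃ ≡ s₂
residues-ap _   false false false _ = refl , refl
residues-ap _   true  true  true  _ = refl , refl
residues-ap one false false true  ()
residues-ap two false false true  ()
residues-ap one false true  false ()
residues-ap two false true  false ()
residues-ap one false true  true  ()
residues-ap two false true  true  ()
residues-ap one true  false false ()
residues-ap two true  false false ()
residues-ap one true  false true  ()
residues-ap two true  false true  ()
residues-ap one true  true  false ()
residues-ap two true  true  false ()


-- x = r + 3t with r ∈ {1, 2} runs through the numbers prime to 3.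
module Construction {r} (ρ : NonZeroDigit r) (t : ℕ) where

  x : ℕ
  x = r + 3 * t

  x>0 : 0 < x
  x>0 = ≤-trans (nonZeroDigit-> ρ) (m≤m+n r _)

  offset : Bool → ℕ
  offset s = if s then x else 0

  Layer : Bool → ℕ → Set
  Layer s z = ∃ λ d → Digits01 d × z ≡ offset s + 3 * d

  Terms : ℕ → Set
  Terms z = Σ Bool λ s → Layer s z

  layer-%3 : ∀ s {z} → Layer s z → z % 3 ≡ residue r s
  layer-%3 false (d , _ , refl) = [e+3q]%3≡e d (s≤s z≤n)
  layer-%3 true  (d , _ , refl) = trans (cong (_% 3) (regroup r t d)) ([e+3q]%3≡e (t + d) (nonZeroDigit-< ρ))
    where
    regroup : ∀ r t d → r + 3 * t + 3 * d ≡ r + 3 * (t + d)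
    regroup = solve-∀

  layer-ap-trivial : ∀ s {u v w} → Layer s u → Layer s v → Layer s w → u + w ≡ 2 * v → u ≡ v
  layer-ap-trivial s (a , da , refl) (b , db , refl) (c , dc , refl) eq =
    cong (λ d → offset s + 3 * d) (digits01-ap-trivial da db dc (Equivalence.to (3*-offset-ap⇔ (offset s) a b c) eq))

  -- Reducing the AP mod 3 shows all three terms lie in the same layer.
  terms-threeFree : ThreeFree Terms
  terms-threeFree u v w (s₁ , lu) (s₂ , lv) (s₃ , lw) u<v _ eq with residues-ap ρ s₁ s₂ s₃ residues-eq
    where
    residues-eq : (residue r s₁ + residue r s₃) % 3 ≡ (2 * residue r s₂) % 3
    residues-eq = trans (cong₂ (λ a c → (a + c) % 3) (sym (layer-%3 s₁ lu)) (sym (layer-%3 s₃ lw)))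
                        (trans (ap-%3 {u} {v} {w} eq) (cong (λ b → (2 * b) % 3) (layer-%3 s₂ lv)))
  ... | refl , refl = <-irrefl (layer-ap-trivial s₂ lu lv lw eq) u<v

  layers-disjoint : ∀ {z} → ¬ (Layer false z × Layer true z)
  layers-disjoint (l₀ , l₁) = <⇒≢ (nonZeroDigit-> ρ) (trans (sym (layer-%3 false l₀)) (layer-%3 true l₁))

  layer0-⇔ : ∀ {e q} → e < 3 → Layer false (e + 3 * q) ⇔ (e ≡ 0 × Digits01 q)
  layer0-⇔ {e} {q} e<3 = mk⇔ to (λ { (refl , dq) → q , dq , refl })
    where
    to : Layer false (e + 3 * q) → e ≡ 0 × Digits01 q
    to (d , dd , eq) with e+3q-injective {q₁ = q} {q₂ = d} e<3 (s≤s z≤n) eq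
    ... | refl , refl = refl , dd

  layer0? : Decidable (Layer false)
  layer0? y with ternary-split y
  ... | e , q , e<3 , refl = Dec.map (⇔-sym (layer0-⇔ e<3)) (e ≟ 0 ×-dec digits01? q)

  layer1-+ : ∀ y → Layer true (x + y) ⇔ Layer false y
  layer1-+ y = mk⇔ (λ (d , dd , eq) → d , dd , +-cancelˡ-≡ x _ _ eq) (λ (d , dd , eq) → d , dd , cong (x +_) eq)

  layer1-≥ : ∀ {z} → Layer true z → x ≤ z
  layer1-≥ (d , _ , refl) = m≤m+n x _

  layer1? : Decidable (Layer true)
  layer1? z with x ≤? z
  ... | no x≰z  = no (x≰z ∘ layer1-≥)
  ... | yes x≤z = subst (Dec ∘ Layer true) (m+[n∸m]≡n x≤z) (Dec.map (⇔-sym (layer1-+ (z ∸ x))) (layer0? (z ∸ x)))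

  terms-⇔-⊎ : ∀ z → Terms z ⇔ (Layer false z ⊎ Layer true z)
  terms-⇔-⊎ z = mk⇔ (λ { (false , l) → inj₁ l ; (true , l) → inj₂ l }) Sum.[ (false ,_) , (true ,_) ]

  terms? : Decidable Terms
  terms? z = Dec.map (⇔-sym (terms-⇔-⊎ z)) (layer0? z ⊎-dec layer1? z)

  member : ∀ s {d} → Digits01 d → Terms (offset s + 3 * d)
  member s dd = s , _ , dd , refl

  layer-blocked : ∀ s m → ¬ Terms (offset s + 3 * m) → Blocked Terms (offset s + 3 * m)
  layer-blocked s m ∉ with digits01⊎blocked m
  ... | inj₁ dm      = ⊥-elim (∉ (member s dm))
  ... | inj₂ blocked = blocked-3* (offset s) (member s) blocked

  double-blocked : ∀ m → Blocked Terms (2 * x + 3 * m)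
  double-blocked m = endsAP⇒blocked x x>0 (member false) (member true) (∈⊎blocked⇒endsAP (digits01⊎blocked m))

  residue-r-blocked : ∀ q → ¬ Terms (r + 3 * q) → x ≤ r + 3 * q → Blocked Terms (r + 3 * q)
  residue-r-blocked q ∉ x≤y = subst (Blocked Terms) (sym y≡) (layer-blocked true (q ∸ t) (∉ ∘ subst Terms (sym y≡)))
    where
    y≡ : r + 3 * q ≡ x + 3 * (q ∸ t)
    y≡ = e+3q≡e+3c+3[q∸c] r t q x≤y

  -- 2x ≡ 3 ∸ r (mod 3), so a number of this residue above 2x is 2x + 3m.
  residue-3∸r-blocked : ∀ q → 2 * x ≤ (3 ∸ r) + 3 * q → Blocked Terms ((3 ∸ r) + 3 * q)
  residue-3∸r-blocked q 2x≤y =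
    subst (Blocked Terms) (sym y≡)
          (subst (λ k → Blocked Terms (k + 3 * (q ∸ c))) (double-r+3t ρ t) (double-blocked (q ∸ c)))
    where
    c : ℕ
    c = 2 * t + (r ∸ 1)
    y≡ : (3 ∸ r) + 3 * q ≡ ((3 ∸ r) + 3 * c) + 3 * (q ∸ c)
    y≡ = e+3q≡e+3c+3[q∸c] (3 ∸ r) c q (subst (_≤ (3 ∸ r) + 3 * q) (double-r+3t ρ t) 2x≤y)

  nonzero-residue-blocked : ∀ {e} → NonZeroDigit e → ∀ q → ¬ Terms (e + 3 * q) → 2 * x < e + 3 * q →
    Blocked Terms (e + 3 * q)
  nonzero-residue-blocked ε q ∉ 2x<y with nonZeroDigit-≡⊎≡3∸ ρ ε
  ... | inj₁ refl = residue-r-blocked q ∉ (≤-trans (m≤m+n x _) (<⇒≤ 2x<y))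
  ... | inj₂ refl = residue-3∸r-blocked q (<⇒≤ 2x<y)

  terms-blocked : ∀ y → ¬ Terms y → 2 * x < y → Blocked Terms y
  terms-blocked y ∉ 2x<y with mod3-view y
  ... | rem0 q = layer-blocked false q ∉
  ... | rem1 q = nonzero-residue-blocked one q ∉ 2x<y
  ... | rem2 q = nonzero-residue-blocked two q ∉ 2x<y

  x+3*allOnes<3^suc : ∀ j → x ≤ j → x + 3 * allOnes j < 3 ^ suc j
  x+3*allOnes<3^suc j x≤j = subst (x + 3 * allOnes j <_) (trans (expand (allOnes j)) (cong (3 *_) (1+2*allOnes≡3^ j)))
    (≤-<-trans (+-monoˡ-≤ (3 * allOnes j) (≤-trans x≤j (n≤allOnes j))) (m<m+n (allOnes j + 3 * allOnes j) (s≤s z≤n)))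
    where
    expand : ∀ w → (w + 3 * w) + suc (2 + 2 * w) ≡ 3 * (1 + 2 * w)
    expand = solve-∀

  x<3^suc : ∀ j → x ≤ j → x < 3 ^ suc j
  x<3^suc j x≤j = ≤-<-trans (m≤m+n x _) (x+3*allOnes<3^suc j x≤j)

  layer-≤ : ∀ s j {z} → Layer s z → z < 3 ^ suc j → z ≤ offset s + 3 * allOnes j
  layer-≤ s j (d , dd , refl) lt =
    +-monoʳ-≤ (offset s) (*-monoʳ-≤ 3 (digits01⇒≤allOnes j dd (e+3q<3^suc⇒q<3^ j (offset s) lt)))

  terms-≤ : ∀ j {z} → Terms z → z < 3 ^ suc j → z ≤ x + 3 * allOnes j
  terms-≤ j (false , l) lt = ≤-trans (layer-≤ false j l lt) (m≤n+m _ x)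
  terms-≤ j (true  , l) lt = layer-≤ true j l lt

  layer0-3^suc+ : ∀ j {y} → y < 3 ^ suc j → Layer false (3 ^ suc j + y) ⇔ Layer false y
  layer0-3^suc+ j {y} lt with ternary-split y
  ... | e , q , e<3 , refl = subst (λ z → Layer false z ⇔ Layer false (e + 3 * q)) (sym (3^+e+3q≡e+3[3^+q] j e q))
    (⇔-sym (layer0-⇔ e<3) ⇔-∘ ((⇔-id _ ×-⇔ digits01-3^+ j (e+3q<3^suc⇒q<3^ j e lt)) ⇔-∘ layer0-⇔ e<3))

  -- With x ≤ j no element of x + 3·D lies in [3^(j+1), 3^(j+1) + x), since x + 3·allOnes j < 3^(j+1).
  layer1-3^suc+ : ∀ j → x ≤ j → ∀ {y} → y < 3 ^ suc j → Layer true (3 ^ suc j + y) ⇔ Layer true y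
  layer1-3^suc+ j x≤j {y} lt with x ≤? y
  ... | yes x≤y = subst (λ z → Layer true (P + z) ⇔ Layer true z) (m+[n∸m]≡n x≤y)
    (⇔-sym (layer1-+ y′) ⇔-∘ (layer0-3^suc+ j (≤-<-trans (m∸n≤m y x) lt) ⇔-∘ (layer1-+ (P + y′) ⇔-∘ reassociate)))
    where
    P  = 3 ^ suc j
    y′ = y ∸ x
    reassociate : Layer true (P + (x + y′)) ⇔ Layer true (x + (P + y′))
    reassociate = subst (λ z → Layer true (P + (x + y′)) ⇔ Layer true z) (x+y+z≡y+[x+z] P x y′) (⇔-id _)
      where
      x+y+z≡y+[x+z] : ∀ a b c → a + (b + c) ≡ b + (a + c)
      x+y+z≡y+[x+z] = solve-∀
  ... | no x≰y = mk⇔ (⊥-elim ∘ too-big) (⊥-elim ∘ x≰y ∘ layer1-≥)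
    where
    P = 3 ^ suc j
    too-big : ¬ Layer true (P + y)
    too-big (d , dd , eq) = <-irrefl (sym eq) (≤-<-trans (+-monoʳ-≤ x (*-monoʳ-≤ 3 d≤allOnes))
                                               (<-≤-trans (x+3*allOnes<3^suc j x≤j) (m≤m+n P y)))
      where
      3d<P : 3 * d < P
      3d<P = +-cancelˡ-< x _ _ (subst (_< x + P) eq (subst (P + y <_) (+-comm P x) (+-monoʳ-< P (≰⇒> x≰y))))
      d≤allOnes : d ≤ allOnes j
      d≤allOnes = digits01⇒≤allOnes j dd (*-cancelˡ-< 3 d (3 ^ j) 3d<P)

  terms-3^suc+ : ∀ j → x ≤ j → ∀ {y} → y < 3 ^ suc j → Terms (3 ^ suc j + y) ⇔ Terms y
  terms-3^suc+ j x≤j lt =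
    mk⇔ (λ (s , l) → s , Equivalence.to (layer-3^suc+ s) l) (λ (s , l) → s , Equivalence.from (layer-3^suc+ s) l)
    where
    layer-3^suc+ : ∀ s → Layer s (3 ^ suc j + _) ⇔ Layer s _
    layer-3^suc+ false = layer0-3^suc+ j lt
    layer-3^suc+ true  = layer1-3^suc+ j x≤j lt

  count-layer0-3* : ∀ n → count layer0? (3 * n) ≡ count digits01? n
  count-layer0-3* n = trans (count-3* layer0? 1 digits01? blocks n) (*-identityˡ _)
    where
    layer0-∉ : ∀ {e} q → 0 < e → e < 3 → ¬ Layer false (e + 3 * q)
    layer0-∉ q e>0 e<3 l = <⇒≢ e>0 (sym (proj₁ (Equivalence.to (layer0-⇔ {q = q} e<3) l)))
    layer0-3*⇔ : ∀ n → Layer false (3 * n) ⇔ Digits01 n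
    layer0-3*⇔ n = mk⇔ (proj₂ ∘ Equivalence.to (layer0-⇔ {0} {n} (s≤s z≤n))) (λ d → n , d , refl)
    blocks : ∀ n → indicator (layer0? (3 * n)) + indicator (layer0? (1 + 3 * n)) + indicator (layer0? (2 + 3 * n))
                   ≡ 1 * indicator (digits01? n)
    blocks n = begin
      _ ≡⟨ cong₂ _+_ (cong₂ _+_ (indicator-⇔ (layer0? (3 * n)) (digits01? n) (layer0-3*⇔ n))
                                (indicator-no (layer0? (1 + 3 * n)) (layer0-∉ n (s≤s z≤n) (s≤s (s≤s z≤n)))))
                     (indicator-no (layer0? (2 + 3 * n)) (layer0-∉ n (s≤s z≤n) (s≤s (s≤s (s≤s z≤n))))) ⟩
      i + 0 + 0 ≡⟨ i+0+0≡1*i i ⟩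
      1 * i     ∎
      where
      open ≡-Reasoning
      i = indicator (digits01? n)
      i+0+0≡1*i : ∀ i → i + 0 + 0 ≡ 1 * i
      i+0+0≡1*i = solve-∀

  count-layer1-+ : ∀ n → count layer1? (x + n) ≡ count layer0? n
  count-layer1-+ n = trans (count-+ layer1? layer0? x n (λ y _ → layer1-+ y))
                           (cong (_+ count layer0? n) (count-skip layer1? 0 x (λ z _ z<x l → <⇒≱ z<x (layer1-≥ l))))

  -- The largest element of 3·D below 3^(j+1) is 3·allOnes j.
  layer0-top-gap : ∀ j → x ≤ j → ∀ z → 3 ^ suc j ∸ x ≤ z → z < 3 ^ suc j → ¬ Layer false z
  layer0-top-gap j x≤j z lo hi l = <⇒≱ (x+3*allOnes<3^suc j x≤j) (begin
    3 ^ suc j               ≡⟨ sym (m∸n+n≡m (<⇒≤ (x<3^suc j x≤j))) ⟩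
    (3 ^ suc j ∸ x) + x     ≤⟨ +-monoˡ-≤ x lo ⟩
    z + x                   ≤⟨ +-monoˡ-≤ x (layer-≤ false j l hi) ⟩
    3 * allOnes j + x       ≡⟨ +-comm _ x ⟩
    x + 3 * allOnes j       ∎)
    where open ≤-Reasoning

  count-terms-3^suc : ∀ j → x ≤ j → count terms? (3 ^ suc j) ≡ 2 ^ suc j
  count-terms-3^suc j x≤j = begin
    count terms? P                          ≡⟨ count-⊎ terms? layer0? layer1? terms-⇔-⊎ (λ _ → layers-disjoint) P ⟩
    count layer0? P + count layer1? P       ≡⟨ cong (count layer0? P +_) layer1-count ⟩
    count layer0? P + count layer0? P       ≡⟨ cong (λ c → c + c) layer0-count ⟩
    2 ^ j + 2 ^ j                           ≡⟨ cong (2 ^ j +_) (sym (+-identityʳ (2 ^ j))) ⟩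
    2 ^ suc j                               ∎
    where
    open ≡-Reasoning
    P = 3 ^ suc j
    x<P : x < P
    x<P = x<3^suc j x≤j
    layer0-count : count layer0? P ≡ 2 ^ j
    layer0-count = trans (count-layer0-3* (3 ^ j)) (count-digits01-3^ j)
    layer1-count : count layer1? P ≡ count layer0? P
    layer1-count = begin
      count layer1? P             ≡⟨ cong (count layer1?) (sym (m+[n∸m]≡n (<⇒≤ x<P))) ⟩
      count layer1? (x + (P ∸ x)) ≡⟨ count-layer1-+ (P ∸ x) ⟩
      count layer0? (P ∸ x)       ≡⟨ sym (count-skip layer0? (P ∸ x) x top-gap) ⟩
      count layer0? ((P ∸ x) + x) ≡⟨ cong (count layer0?) (m∸n+n≡m (<⇒≤ x<P)) ⟩
      count layer0? P             ∎
      where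
      top-gap : ∀ z → P ∸ x ≤ z → z < (P ∸ x) + x → ¬ Layer false z
      top-gap z lo hi = layer0-top-gap j x≤j z lo (subst (z <_) (m∸n+n≡m (<⇒≤ x<P)) hi)

  terms-3^suc : ∀ j → Terms (3 ^ suc j)
  terms-3^suc j = member false (digits01-3^ j)

  unbounded : ∀ m → ∃ λ y → m < y × Terms y
  unbounded m = 3 ^ suc m , <-≤-trans (n<3^n m) (m≤n*m (3 ^ m) 3) , terms-3^suc m

  open Enumeration terms? (member false []) unbounded public

  enum-2^suc : ∀ j → x ≤ j → enum (2 ^ suc j) ≡ 3 ^ suc j
  enum-2^suc j x≤j = trans (cong enum (sym (count-terms-3^suc j x≤j))) (enum-count (terms-3^suc j))

  enum-2^suc∸1 : ∀ j → x ≤ j → enum (2 ^ suc j ∸ 1) ≡ x + 3 * allOnes j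
  enum-2^suc∸1 j x≤j = enum-last-below (2 ^ suc j) (member true (digits01-allOnes j)) below-top nothing-between
    where
    top≡ = enum-2^suc j x≤j
    below-top : x + 3 * allOnes j < enum (2 ^ suc j)
    below-top = subst (x + 3 * allOnes j <_) (sym top≡) (x+3*allOnes<3^suc j x≤j)
    nothing-between : ∀ z → x + 3 * allOnes j < z → z < enum (2 ^ suc j) → ¬ Terms z
    nothing-between z lo hi tz = <⇒≱ lo (terms-≤ j tz (subst (z <_) top≡ hi))

  independent : ∀ lam → lam + 2 ≡ 2 * x → IndependentWithCharacter enum lam
  independent lam char = suc x , λ { zero () ; (suc j) (s≤s x≤j) → doubling-block j x≤j , character j x≤j }
    where
    doubling-block : ∀ j → x ≤ j → ∀ i → i < 2 ^ suc j → enum (2 ^ suc j + i) ≡ enum (2 ^ suc j) + enum i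
    doubling-block j x≤j = enum-+ (2 ^ suc j) λ y y<top →
      subst (λ T → Terms (T + y) ⇔ Terms y) (sym (enum-2^suc j x≤j))
            (terms-3^suc+ j x≤j (subst (y <_) (enum-2^suc j x≤j) y<top))
    character : ∀ j → x ≤ j → enum (2 ^ suc j) + lam ≡ 2 * enum (2 ^ suc j ∸ 1) + 1
    character j x≤j = begin
      enum (2 ^ suc j) + lam        ≡⟨ cong (_+ lam) (trans (enum-2^suc j x≤j) (cong (3 *_) (sym (1+2*allOnes≡3^ j)))) ⟩
      3 * (1 + 2 * allOnes j) + lam ≡⟨ +-cancelʳ-≡ 2 _ _ (plus-2 (allOnes j)) ⟩
      2 * (x + 3 * allOnes j) + 1   ≡⟨ cong (λ y → 2 * y + 1) (sym (enum-2^suc∸1 j x≤j)) ⟩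
      2 * enum (2 ^ suc j ∸ 1) + 1  ∎
      where
      open ≡-Reasoning
      rearrange : ∀ x w → 3 * (1 + 2 * w) + 2 * x ≡ (2 * (x + 3 * w) + 1) + 2
      rearrange = solve-∀
      plus-2 : ∀ w → 3 * (1 + 2 * w) + lam + 2 ≡ 2 * (x + 3 * w) + 1 + 2
      plus-2 w = begin
        3 * (1 + 2 * w) + lam + 2   ≡⟨ +-assoc _ lam 2 ⟩
        3 * (1 + 2 * w) + (lam + 2) ≡⟨ cong (3 * (1 + 2 * w) +_) char ⟩
        3 * (1 + 2 * w) + 2 * x     ≡⟨ rearrange x w ⟩
        2 * (x + 3 * w) + 1 + 2     ∎

  isStanleySeq : IsStanleySeqOf (applyUpTo enum (suc (2 * x))) enum
  isStanleySeq = isStanleySeqOf terms-threeFree (2 * x) terms-blocked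

  basis : ℕ → ℕ
  basis zero    = x
  basis (suc k) = 3 ^ suc k

  subsetSum-basis : ∀ δ n → subsetSum basis δ (suc n) ≡ offset (δ 0) + 3 * subsetSum (3 ^_) (δ ∘ suc) n
  subsetSum-basis δ n = trans (subsetSum-uncons basis δ n) (cong (offset (δ 0) +_) (subsetSum-3* (3 ^_) (δ ∘ suc) n))

  terms⇔subsetSum : ∀ z → Terms z ⇔ (∃₂ λ n δ → z ≡ subsetSum basis δ n)
  terms⇔subsetSum z = mk⇔ to from
    where
    to : ∀ {z} → Terms z → ∃₂ λ n δ → z ≡ subsetSum basis δ n
    to (s , d , dd , refl) with digits01⇒subsetSum-3^ dd
    ... | n , δ , refl = suc n , prepend s δ , sym (subsetSum-basis (prepend s δ) n)
    from : ∀ {z} → (∃₂ λ n δ → z ≡ subsetSum basis δ n) → Terms z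
    from (zero  , δ , refl) = member false []
    from (suc n , δ , refl) = subst Terms (sym (subsetSum-basis δ n)) (member (δ 0) (digits01-subsetSum-3^ (δ ∘ suc) n))

  isBasis : IsBasis enum basis
  isBasis = (1 , 1 , λ { zero () ; (suc k) _ → sym (*-identityˡ _) }) ,
            λ z → mk⇔ (λ (i , enum-i≡z) → Equivalence.to (terms⇔subsetSum z) (subst Terms enum-i≡z (enum-∈ i)))
                      (λ sum → count terms? z , enum-count (Equivalence.from (terms⇔subsetSum z) sum))


character-witness : ∀ lam → lam % 6 ≡ 0 ⊎ lam % 6 ≡ 2 → ∃₂ λ r t → NonZeroDigit r × lam + 2 ≡ 2 * (r + 3 * t)
character-witness lam lam%6 with lam % 6 | m≡m%n+[m/n]*n lam 6
character-witness lam (inj₁ refl) | _ | lam≡ = 1 , lam / 6 , one , trans (cong (_+ 2) lam≡) (rearrange (lam / 6))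
  where
  rearrange : ∀ t → 0 + t * 6 + 2 ≡ 2 * (1 + 3 * t)
  rearrange = solve-∀
character-witness lam (inj₂ refl) | _ | lam≡ = 2 , lam / 6 , two , trans (cong (_+ 2) lam≡) (rearrange (lam / 6))
  where
  rearrange : ∀ t → 2 + t * 6 + 2 ≡ 2 * (2 + 3 * t)
  rearrange = solve-∀

lemma2p3 : (lam : ℕ) → (lam % 6 ≡ 0 ⊎ lam % 6 ≡ 2) →
    (∃[ a ] (IsStanleySeq a × IndependentWithCharacter a lam))
    × (∃[ a ] (IsStanleySeq a × IndependentWithCharacter a lam × IsBasic a))
lemma2p3 lam lam%6 with character-witness lam lam%6
... | r , t , ρ , char =
  (enum , stanley , independent lam char) , (enum , stanley , independent lam char , basis , isBasis)
  where
  open Construction ρ t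
  stanley : IsStanleySeq enum
  stanley = _ , isStanleySeq
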